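{- Let $F=F(X)$ be a Boolean function, let $Y$ and $Y'$ be disjoint subsets of $X$, and let $\mathcal{H}\subseteq\mathsf{factors}(F,Y\cup Y')$. Then $$\{\mathsf{sat}(G)\times\mathsf{sat}(G'): (G,G')\in\mathsf{impl}(F,H,Y,Y'),\ H\in\mathcal{H}\}$$ is a disjoint rectangle cover of $\bigvee_{H\in\mathcal{H}}H$; that is, $\mathsf{sat}(\bigvee_{H\in\mathcal{H}}H)$ is the union of these sets and the union is disjoint.
   Context: A Boolean function over a finite set $X$ is a map $F\colon\{0,1\}^X\to\{0,1\}$; $\mathsf{sat}(F)=F^{ -1}(1)$. For disjoint $Y,Y'$, $B\subseteq\{0,1\}^Y$, $B'\subseteq\{0,1\}^{Y'}$, $B\times B'=\{b\cup b': b\in B,b'\in B'\}$ with $b\cup b'$ the combined assignment. For a set $Y$ and $b\colon Y\cap X\to\{0,1\}$, the cofactor $F(b,X\setminus Y)$ is $b'\mapsto F(b\cup b')$ on $\{0,1\}^{X\setminus Y}$. A function $G$ on $\{0,1\}^{Y\cap X}$ is a factor of $F$ relative to $Y$ if for some cofactor $F'$ of $F$ induced by an assignment of $Y\cap X$, $G(b)=1$ iff $F(b,X\setminus Y)=F'$; $\mathsf{factors}(F,Y)$ is the set of factors. For disjoint $Y,Y'\subseteq X$ and $H\in\mathsf{factors}(F,Y\cup Y')$, $\mathsf{impl}(F,H,Y,Y')$ is the set of pairs $(G,G')\in\mathsf{factors}(F,Y)\times\mathsf{factors}(F,Y')$ with $\mathsf{sat}(G)\times\mathsf{sat}(G')\subseteq\mathsf{sat}(H)$.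 $\bigvee_{H\in\mathcal{H}}H$ is the pointwise disjunction of the functions in $\mathcal{H}$. -}

module Defs where

open import Data.Bool using (Bool; true; false)
open import Data.Maybe using (Maybe; just; nothing; is-just)
open import Data.Nat using (ℕ)
open import Data.Fin using (Fin)
open import Data.Fin.Subset using (Subset; ⊤; ∁; _∪_; _∩_; Empty)
open import Data.Vec using (Vec; map; zipWith)
open import Data.Product using (Σ; Σ-syntax; ∃; _×_)
open import Function.Bundles using (_⇔_)
open import Relation.Binary.PropositionalEquality using (_≡_)

-- Variables are X = Fin n.  A (partial) assignment is a vector of
-- Maybe Bool: position i holds 'just v' if variable i is assigned v,
-- and 'nothing' if i is not in the domain of the assignment.
Asg : ℕ → Set
Asg n = Vec (Maybe Bool) n

-- An assignment is an element of {0,1}^Y iff its domain is exactly Y.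
dom : ∀ {n} → Asg n → Subset n
dom = map is-just

AsgOn : ∀ {n} → Subset n → Asg n → Set
AsgOn Y b = dom b ≡ Y

combine : Maybe Bool → Maybe Bool → Maybe Bool
combine (just x) _ = just x
combine nothing  y = y

_∪ₐ_ : ∀ {n} → Asg n → Asg n → Asg n
_∪ₐ_ = zipWith combine

-- A Boolean function on {0,1}^Y is represented by a map Asg n → Bool;
-- only its values on assignments with domain Y are ever used.
BFun : ℕ → Set
BFun n = Asg n → Bool

Sat : ∀ {n} → Subset n → BFun n → Asg n → Set
Sat Y G b = AsgOn Y b × G b ≡ true

DisjointVars : ∀ {n} → Subset n → Subset n → Set
DisjointVars Y Y' = Empty (Y ∩ Y')

-- For F over X = ⊤ and b, b₀ assignments of Y: the cofactors
-- F(b, X∖Y) and F(b₀, X∖Y) are equal (as functions on {0,1}^{X∖Y}).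
SameCofactor : ∀ {n} → BFun n → Subset n → Asg n → Asg n → Set
SameCofactor F Y b b₀ = ∀ b' → AsgOn (∁ Y) b' → F (b ∪ₐ b') ≡ F (b₀ ∪ₐ b')

-- G ∈ factors(F, Y): for some assignment b₀ of Y (inducing the cofactor
-- F' = F(b₀, X∖Y)), G(b) = 1 iff F(b, X∖Y) = F', for all b ∈ {0,1}^Y.
IsFactor : ∀ {n} → BFun n → Subset n → BFun n → Set
IsFactor F Y G =
  Σ[ b₀ ∈ Asg _ ] (AsgOn Y b₀ ×
    (∀ b → AsgOn Y b → (G b ≡ true ⇔ SameCofactor F Y b b₀)))

Rect : ∀ {n} → Subset n → Subset n → BFun n → BFun n → Asg n → Set
Rect Y Y' G G' c =
  Σ[ b ∈ Asg _ ] Σ[ b' ∈ Asg _ ] (Sat Y G b × Sat Y' G' b' × c ≡ b ∪ₐ b')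

Impl : ∀ {n} → BFun n → BFun n → Subset n → Subset n → BFun n → BFun n → Set
Impl F H Y Y' G G' =
  IsFactor F Y G × IsFactor F Y' G' ×
  (∀ c → Rect Y Y' G G' c → Sat (Y ∪ Y') H c)

SatDisj : ∀ {n} → Subset n → (BFun n → Set) → Asg n → Set
SatDisj Z ℋ c = AsgOn Z c × Σ[ H ∈ BFun _ ] (ℋ H × H c ≡ true)

-- Membership of a point c in a member of the family
-- { sat(G) × sat(G') : (G,G') ∈ impl(F,H,Y,Y'), H ∈ ℋ }, indexed by (G,G',H).
InFamily : ∀ {n} → BFun n → Subset n → Subset n → (BFun n → Set) →
           BFun n → BFun n → BFun n → Set
InFamily F Y Y' ℋ G G' H = ℋ H × Impl F H Y Y' G G'

-- A factor of F relative to Y is the indicator of one class of the equivalence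
-- "same cofactor" on assignments of Y.  This equivalence is compatible with
-- combining assignments of disjoint variable sets, so the rectangle formed by the
-- classes of the Y- and Y'-parts of a point c lies in the class of c, i.e. inside
-- the factor H ∈ ℋ satisfied by c: this gives the cover.  A point determines its
-- Y- and Y'-parts, and two factors sharing a point coincide, so two rectangles of
-- the family that meet are equal: this gives disjointness.

module Submission where

open import Defs
open import Data.Nat using (ℕ)
open import Data.Bool using (true; false)
import Data.Bool.Properties as Bool
open import Data.Maybe using (just; nothing; is-just)
open import Data.Vec using ([]; _∷_)
open import Data.Vec.Properties using (∷-injectiveʳ)
open import Data.Fin.Subset using (Subset; ∁; _∪_; _∩_) renaming (⊥ to ∅)
open import Data.Fin.Subset.Properties using (Empty-unique; ∪-comm; ∩-comm; ∩-abs-∪)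
open import Data.Product using (Σ-syntax; _×_; _,_; proj₁)
open import Function using (_∘_)
open import Function.Bundles using (_⇔_; mk⇔; Equivalence)
open import Relation.Nullary using (Dec; yes; does)
open import Relation.Nullary.Decidable using (map′; _×-dec_; dec-true)
open import Level using (0ℓ)
open import Relation.Unary using (Pred; Decidable)
open import Relation.Binary.PropositionalEquality

private
  variable
    n : ℕ
    Y Y' : Subset n
    a a' b b' b₀ b₀' c d e : Asg n
    G G₁ G₁' G₂ G₂' H : BFun n
    A : Set

Disjoint : Subset n → Subset n → Set
Disjoint Y Y' = Y ∩ Y' ≡ ∅

Disjoint-sym : Disjoint Y Y' → Disjoint Y' Y
Disjoint-sym {Y = Y} {Y' = Y'} disj = trans (∩-comm Y' Y) disj

∪-∁-∪ : (Y Y' : Subset n) → Disjoint Y Y' → Y' ∪ ∁ (Y ∪ Y') ≡ ∁ Y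
∪-∁-∪ []          []           _ = refl
∪-∁-∪ (true ∷ Y)  (true ∷ Y')  ()
∪-∁-∪ (true ∷ Y)  (false ∷ Y') d = cong (false ∷_) (∪-∁-∪ Y Y' (∷-injectiveʳ d))
∪-∁-∪ (false ∷ Y) (true ∷ Y')  d = cong (true ∷_)  (∪-∁-∪ Y Y' (∷-injectiveʳ d))
∪-∁-∪ (false ∷ Y) (false ∷ Y') d = cong (true ∷_)  (∪-∁-∪ Y Y' (∷-injectiveʳ d))

dom-∪ₐ : (a b : Asg n) → dom (a ∪ₐ b) ≡ dom a ∪ dom b
dom-∪ₐ []            []      = refl
dom-∪ₐ (just _ ∷ a)  (_ ∷ b) = cong (true ∷_) (dom-∪ₐ a b)
dom-∪ₐ (nothing ∷ a) (x ∷ b) = cong (is-just x ∷_) (dom-∪ₐ a b)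

AsgOn-∪ₐ : AsgOn Y a → AsgOn Y' b → AsgOn (Y ∪ Y') (a ∪ₐ b)
AsgOn-∪ₐ {a = a} {b = b} refl refl = dom-∪ₐ a b

∪ₐ-assoc : (a b e : Asg n) → (a ∪ₐ b) ∪ₐ e ≡ a ∪ₐ (b ∪ₐ e)
∪ₐ-assoc []            []      []      = refl
∪ₐ-assoc (just x ∷ a)  (_ ∷ b) (_ ∷ e) = cong (just x ∷_) (∪ₐ-assoc a b e)
∪ₐ-assoc (nothing ∷ a) (y ∷ b) (z ∷ e) = cong (combine y z ∷_) (∪ₐ-assoc a b e)

∪ₐ-comm : (a b : Asg n) → Disjoint (dom a) (dom b) → a ∪ₐ b ≡ b ∪ₐ a
∪ₐ-comm []            []            _ = refl
∪ₐ-comm (just _ ∷ a)  (just _ ∷ b)  ()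
∪ₐ-comm (just x ∷ a)  (nothing ∷ b) d = cong (just x ∷_)  (∪ₐ-comm a b (∷-injectiveʳ d))
∪ₐ-comm (nothing ∷ a) (just y ∷ b)  d = cong (just y ∷_)  (∪ₐ-comm a b (∷-injectiveʳ d))
∪ₐ-comm (nothing ∷ a) (nothing ∷ b) d = cong (nothing ∷_) (∪ₐ-comm a b (∷-injectiveʳ d))

∪ₐ-comm-on : Disjoint Y Y' → AsgOn Y a → AsgOn Y' b → a ∪ₐ b ≡ b ∪ₐ a
∪ₐ-comm-on {a = a} {b = b} disj refl refl = ∪ₐ-comm a b disj

restrict : Subset n → Asg n → Asg n
restrict []          []      = []
restrict (true ∷ Y)  (x ∷ c) = x ∷ restrict Y c
restrict (false ∷ Y) (_ ∷ c) = nothing ∷ restrict Y c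

dom-restrict : (Y : Subset n) (c : Asg n) → dom (restrict Y c) ≡ Y ∩ dom c
dom-restrict []          []      = refl
dom-restrict (true ∷ Y)  (x ∷ c) = cong (is-just x ∷_) (dom-restrict Y c)
dom-restrict (false ∷ Y) (_ ∷ c) = cong (false ∷_) (dom-restrict Y c)

restrict-∪ : (Y Y' : Subset n) (c : Asg n) → restrict Y c ∪ₐ restrict Y' c ≡ restrict (Y ∪ Y') c
restrict-∪ []          []           []            = refl
restrict-∪ (true ∷ Y)  (true ∷ Y')  (just x ∷ c)  = cong (just x ∷_) (restrict-∪ Y Y' c)
restrict-∪ (true ∷ Y)  (true ∷ Y')  (nothing ∷ c) = cong (nothing ∷_) (restrict-∪ Y Y' c)
restrict-∪ (true ∷ Y)  (false ∷ Y') (just x ∷ c)  = cong (just x ∷_) (restrict-∪ Y Y' c)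
restrict-∪ (true ∷ Y)  (false ∷ Y') (nothing ∷ c) = cong (nothing ∷_) (restrict-∪ Y Y' c)
restrict-∪ (false ∷ Y) (true ∷ Y')  (x ∷ c)       = cong (x ∷_) (restrict-∪ Y Y' c)
restrict-∪ (false ∷ Y) (false ∷ Y') (_ ∷ c)       = cong (nothing ∷_) (restrict-∪ Y Y' c)

restrict-dom-∪ₐ : (b b' : Asg n) → restrict (dom b) (b ∪ₐ b') ≡ b
restrict-dom-∪ₐ []            []      = refl
restrict-dom-∪ₐ (just x ∷ b)  (_ ∷ b') = cong (just x ∷_) (restrict-dom-∪ₐ b b')
restrict-dom-∪ₐ (nothing ∷ b) (_ ∷ b') = cong (nothing ∷_) (restrict-dom-∪ₐ b b')

restrict-dom : (c : Asg n) → restrict (dom c) c ≡ c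
restrict-dom []            = refl
restrict-dom (just x ∷ c)  = cong (just x ∷_) (restrict-dom c)
restrict-dom (nothing ∷ c) = cong (nothing ∷_) (restrict-dom c)

restrict-split : (Y Y' : Subset n) → AsgOn (Y ∪ Y') c → restrict Y c ∪ₐ restrict Y' c ≡ c
restrict-split {c = c} Y Y' c∈ =
  trans (restrict-∪ Y Y' c) (subst (λ Z → restrict Z c ≡ c) c∈ (restrict-dom c))

AsgOn-restrictˡ : (Y Y' : Subset n) → AsgOn (Y ∪ Y') c → AsgOn Y (restrict Y c)
AsgOn-restrictˡ {c = c} Y Y' c∈ =
  trans (dom-restrict Y c) (trans (cong (Y ∩_) c∈) (∩-abs-∪ Y Y'))

AsgOn-restrictʳ : (Y Y' : Subset n) → AsgOn (Y ∪ Y') c → AsgOn Y' (restrict Y' c)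
AsgOn-restrictʳ Y Y' c∈ = AsgOn-restrictˡ Y' Y (trans c∈ (∪-comm Y Y'))

∪ₐ-injectiveˡ : AsgOn Y a → AsgOn Y b → a ∪ₐ a' ≡ b ∪ₐ b' → a ≡ b
∪ₐ-injectiveˡ {a = a} {b = b} {a' = a'} {b' = b'} refl b∈ eq = begin
  a                          ≡˘⟨ restrict-dom-∪ₐ a a' ⟩
  restrict (dom a) (a ∪ₐ a') ≡⟨ cong₂ restrict (sym b∈) eq ⟩
  restrict (dom b) (b ∪ₐ b') ≡⟨ restrict-dom-∪ₐ b b' ⟩
  b                          ∎
  where open ≡-Reasoning

∪ₐ-injective : Disjoint Y Y' → AsgOn Y a → AsgOn Y b → AsgOn Y' a' → AsgOn Y' b' →
               a ∪ₐ a' ≡ b ∪ₐ b' → a ≡ b × a' ≡ b'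
∪ₐ-injective {a = a} {b = b} {a' = a'} {b' = b'} disj a∈ b∈ a'∈ b'∈ eq =
  ∪ₐ-injectiveˡ a∈ b∈ eq , ∪ₐ-injectiveˡ a'∈ b'∈ swapped
  where
  open ≡-Reasoning
  swapped : a' ∪ₐ a ≡ b' ∪ₐ b
  swapped = begin
    a' ∪ₐ a ≡˘⟨ ∪ₐ-comm-on disj a∈ a'∈ ⟩
    a ∪ₐ a' ≡⟨ eq ⟩
    b ∪ₐ b' ≡⟨ ∪ₐ-comm-on disj b∈ b'∈ ⟩
    b' ∪ₐ b ∎

∀-AsgOn? : (Z : Subset n) {P : Pred (Asg n) 0ℓ} → Decidable P → Dec (∀ b → AsgOn Z b → P b)
∀-AsgOn? []          P? = map′ (λ p → λ { [] refl → p }) (λ f → f [] refl) (P? [])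
∀-AsgOn? (true ∷ Z)  {P} P? =
  map′ (λ (p , q) → λ { (just true ∷ r) r∈ → p r (∷-injectiveʳ r∈)
                      ; (just false ∷ r) r∈ → q r (∷-injectiveʳ r∈)
                      ; (nothing ∷ r) () })
       (λ f → (λ r r∈ → f (just true ∷ r) (cong (true ∷_) r∈)) ,
              (λ r r∈ → f (just false ∷ r) (cong (true ∷_) r∈)))
       (∀-AsgOn? Z {P ∘ (just true ∷_)} (P? ∘ (just true ∷_)) ×-dec
        ∀-AsgOn? Z {P ∘ (just false ∷_)} (P? ∘ (just false ∷_)))
∀-AsgOn? (false ∷ Z) {P} P? =
  map′ (λ p → λ { (just _ ∷ r) () ; (nothing ∷ r) r∈ → p r (∷-injectiveʳ r∈) })
       (λ f r r∈ → f (nothing ∷ r) (cong (false ∷_) r∈))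
       (∀-AsgOn? Z {P ∘ (nothing ∷_)} (P? ∘ (nothing ∷_)))

dec-true⁻¹ : (a? : Dec A) → does a? ≡ true → A
dec-true⁻¹ (yes a) _ = a

module _ {n : ℕ} (F : BFun n) where

  SameCofactor-refl : SameCofactor F Y b b
  SameCofactor-refl _ _ = refl

  SameCofactor-sym : SameCofactor F Y b b₀ → SameCofactor F Y b₀ b
  SameCofactor-sym s e e∈ = sym (s e e∈)

  SameCofactor-trans : SameCofactor F Y a b → SameCofactor F Y b c → SameCofactor F Y a c
  SameCofactor-trans s t e e∈ = trans (s e e∈) (t e e∈)

  SameCofactor-∪ₐˡ : Disjoint Y Y' → AsgOn Y' b' →
                     SameCofactor F Y b b₀ → SameCofactor F (Y ∪ Y') (b ∪ₐ b') (b₀ ∪ₐ b')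
  SameCofactor-∪ₐˡ {Y = Y} {Y' = Y'} {b' = b'} {b = b} {b₀ = b₀} disj b'∈ s e e∈ = begin
    F ((b ∪ₐ b') ∪ₐ e)  ≡⟨ cong F (∪ₐ-assoc b b' e) ⟩
    F (b ∪ₐ (b' ∪ₐ e))  ≡⟨ s (b' ∪ₐ e) (trans (AsgOn-∪ₐ b'∈ e∈) (∪-∁-∪ Y Y' disj)) ⟩
    F (b₀ ∪ₐ (b' ∪ₐ e)) ≡˘⟨ cong F (∪ₐ-assoc b₀ b' e) ⟩
    F ((b₀ ∪ₐ b') ∪ₐ e) ∎
    where open ≡-Reasoning

  SameCofactor-∪ₐ : Disjoint Y Y' → AsgOn Y b₀ → AsgOn Y' b' → AsgOn Y' b₀' →
                    SameCofactor F Y b b₀ → SameCofactor F Y' b' b₀' →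
                    SameCofactor F (Y ∪ Y') (b ∪ₐ b') (b₀ ∪ₐ b₀')
  SameCofactor-∪ₐ {Y = Y} {Y' = Y'} {b₀ = b₀} {b' = b'} {b₀' = b₀'} disj b₀∈ b'∈ b₀'∈ s s' =
    SameCofactor-trans (SameCofactor-∪ₐˡ disj b'∈ s) second-component
    where
    second-component : SameCofactor F (Y ∪ Y') (b₀ ∪ₐ b') (b₀ ∪ₐ b₀')
    second-component
      rewrite ∪ₐ-comm-on disj b₀∈ b'∈ | ∪ₐ-comm-on disj b₀∈ b₀'∈ | ∪-comm Y Y'
      = SameCofactor-∪ₐˡ (Disjoint-sym disj) b₀∈ s'

  SameCofactor? : (Y : Subset n) (b b₀ : Asg n) → Dec (SameCofactor F Y b b₀)
  SameCofactor? Y b b₀ = ∀-AsgOn? (∁ Y) (λ e → F (b ∪ₐ e) Bool.≟ F (b₀ ∪ₐ e))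

  cofactorClass : Subset n → Asg n → BFun n
  cofactorClass Y b₀ b = does (SameCofactor? Y b b₀)

  cofactorClass-isFactor : AsgOn Y b₀ → IsFactor F Y (cofactorClass Y b₀)
  cofactorClass-isFactor {Y = Y} {b₀ = b₀} b₀∈ =
    b₀ , b₀∈ , λ b _ → mk⇔ (dec-true⁻¹ (SameCofactor? Y b b₀)) (dec-true (SameCofactor? Y b b₀))

  cofactorClass-self : AsgOn Y b₀ → Sat Y (cofactorClass Y b₀) b₀
  cofactorClass-self {Y = Y} {b₀ = b₀} b₀∈ =
    b₀∈ , dec-true (SameCofactor? Y b₀ b₀) SameCofactor-refl

  factor-SameCofactor : IsFactor F Y G → Sat Y G b → Sat Y G e → SameCofactor F Y b e
  factor-SameCofactor (b₀ , _ , G⇔) (b∈ , Gb) (e∈ , Ge) =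
    SameCofactor-trans (Equivalence.to (G⇔ _ b∈) Gb)
                       (SameCofactor-sym (Equivalence.to (G⇔ _ e∈) Ge))

  SameCofactor-factor : IsFactor F Y G → Sat Y G b → AsgOn Y e → SameCofactor F Y e b → Sat Y G e
  SameCofactor-factor (b₀ , _ , G⇔) (b∈ , Gb) e∈ e~b =
    e∈ , Equivalence.from (G⇔ _ e∈) (SameCofactor-trans e~b (Equivalence.to (G⇔ _ b∈) Gb))

  meeting-factors-⊆ : IsFactor F Y G₁ → IsFactor F Y G₂ →
                      Sat Y G₁ b → Sat Y G₂ b → Sat Y G₁ e → Sat Y G₂ e
  meeting-factors-⊆ f₁ f₂ b∈G₁ b∈G₂ e∈G₁ =
    SameCofactor-factor f₂ b∈G₂ (proj₁ e∈G₁) (factor-SameCofactor f₁ e∈G₁ b∈G₁)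

  meeting-rectangles-⊆ : Disjoint Y Y' →
                         IsFactor F Y G₁ → IsFactor F Y G₂ → IsFactor F Y' G₁' → IsFactor F Y' G₂' →
                         Rect Y Y' G₁ G₁' c → Rect Y Y' G₂ G₂' c →
                         Rect Y Y' G₁ G₁' d → Rect Y Y' G₂ G₂' d
  meeting-rectangles-⊆ disj f₁ f₂ f₁' f₂'
    (b₁ , b₁' , s₁ , s₁' , c≡₁) (b₂ , b₂' , s₂ , s₂' , c≡₂) (e , e' , t , t' , d≡)
    with ∪ₐ-injective disj (proj₁ s₁) (proj₁ s₂) (proj₁ s₁') (proj₁ s₂') (trans (sym c≡₁) c≡₂)
  ... | refl , refl =
    e , e' , meeting-factors-⊆ f₁ f₂ s₁ s₂ t , meeting-factors-⊆ f₁' f₂' s₁' s₂' t' , d≡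

  cofactorClasses-rect : (Y Y' : Subset n) → AsgOn (Y ∪ Y') c →
                         Rect Y Y' (cofactorClass Y (restrict Y c)) (cofactorClass Y' (restrict Y' c)) c
  cofactorClasses-rect {c = c} Y Y' c∈ =
    restrict Y c , restrict Y' c ,
    cofactorClass-self (AsgOn-restrictˡ Y Y' c∈) ,
    cofactorClass-self (AsgOn-restrictʳ Y Y' c∈) ,
    sym (restrict-split Y Y' c∈)

  cofactorClasses-impl : Disjoint Y Y' → IsFactor F (Y ∪ Y') H → Sat (Y ∪ Y') H c →
                         Impl F H Y Y' (cofactorClass Y (restrict Y c)) (cofactorClass Y' (restrict Y' c))
  cofactorClasses-impl {Y = Y} {Y' = Y'} {H = H} {c = c} disj fH (c∈ , Hc) =
    cofactorClass-isFactor b₀∈ , cofactorClass-isFactor b₀'∈ , rect⊆H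
    where
    b₀∈ : AsgOn Y (restrict Y c)
    b₀∈ = AsgOn-restrictˡ Y Y' c∈
    b₀'∈ : AsgOn Y' (restrict Y' c)
    b₀'∈ = AsgOn-restrictʳ Y Y' c∈
    rect⊆H : ∀ d → Rect Y Y' (cofactorClass Y (restrict Y c)) (cofactorClass Y' (restrict Y' c)) d →
             Sat (Y ∪ Y') H d
    rect⊆H _ (b , b' , (b∈ , Gb) , (b'∈ , G'b') , refl) =
      SameCofactor-factor fH (c∈ , Hc) (AsgOn-∪ₐ b∈ b'∈)
        (subst (SameCofactor F (Y ∪ Y') (b ∪ₐ b')) (restrict-split Y Y' c∈)
          (SameCofactor-∪ₐ disj b₀∈ b'∈ b₀'∈
            (dec-true⁻¹ (SameCofactor? Y b (restrict Y c)) Gb)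
            (dec-true⁻¹ (SameCofactor? Y' b' (restrict Y' c)) G'b')))

lemma5 : ∀ {n} (F : BFun n) (Y Y' : Subset n) → DisjointVars Y Y' →
    (ℋ : BFun n → Set) → (∀ H → ℋ H → IsFactor F (Y ∪ Y') H) →
    ((c : Asg n) → SatDisj (Y ∪ Y') ℋ c ⇔
      (Σ[ G ∈ BFun n ] Σ[ G' ∈ BFun n ] Σ[ H ∈ BFun n ]
        (InFamily F Y Y' ℋ G G' H × Rect Y Y' G G' c)))
    ×
    ((G₁ G₁' H₁ G₂ G₂' H₂ : BFun n) →
      InFamily F Y Y' ℋ G₁ G₁' H₁ → InFamily F Y Y' ℋ G₂ G₂' H₂ →
      (c : Asg n) → Rect Y Y' G₁ G₁' c → Rect Y Y' G₂ G₂' c →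
      (d : Asg n) → (Rect Y Y' G₁ G₁' d ⇔ Rect Y Y' G₂ G₂' d))
lemma5 F Y Y' no-common-var ℋ ℋ-factors =
  (λ c → mk⇔
    (λ { (c∈ , H , H∈ℋ , Hc) →
           _ , _ , H , (H∈ℋ , cofactorClasses-impl F disj (ℋ-factors H H∈ℋ) (c∈ , Hc)) ,
           cofactorClasses-rect F Y Y' c∈ })
    (λ { (_ , _ , H , (H∈ℋ , _ , _ , rect⊆H) , c∈rect) →
           let (c∈ , Hc) = rect⊆H c c∈rect in c∈ , H , H∈ℋ , Hc })) ,
  λ { _ _ _ _ _ _ (_ , f₁ , f₁' , _) (_ , f₂ , f₂' , _) _ c∈R₁ c∈R₂ _ →
        mk⇔ (meeting-rectangles-⊆ F disj f₁ f₂ f₁' f₂' c∈R₁ c∈R₂)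
            (meeting-rectangles-⊆ F disj f₂ f₁ f₂' f₁' c∈R₂ c∈R₁) }
  where
  disj : Disjoint Y Y'
  disj = Empty-unique no-common-var
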